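{- Let $R$ be a finite undirected graph and let $\mathfrak{U}'$ be a class of finite undirected graphs, and assume that either $\mathfrak{U}'=\mathfrak{U}$, or $R\in\mathfrak{C}_o$ and $\mathfrak{C}_o\subseteq\mathfrak{U}'\subseteq\mathfrak{U}$. Then for every finite undirected graph $S$: $$R\sqsubseteq_\Gamma S \text{ with respect to } \mathfrak{U}' \iff \#\mathcal{S}_u(G,R)\le\#\mathcal{S}_u(G,S)\text{ for all } G\in\mathfrak{U}',$$ and $\#\mathcal{S}_u(G,R)\le\#\mathcal{S}_u(G,S)$ for all $G\in\mathfrak{U}'$ implies $\#\mathcal{H}_u(G,R)\le\#\mathcal{H}_u(G,S)$ for all $G\in\mathfrak{U}'$.
   Context: An undirected graph $G$ has a finite non-empty vertex set $V(G)$ and an edge set $E(G)$ of one- or two-element subsets of $V(G)$; one-element edges are loops. $\mathfrak{U}$ is the class of all finite undirected graphs, $G^*$ is $G$ with loops removed, and $\mathfrak{C}_o=\{G\in\mathfrak{U}: G^* \text{ contains no cycle of odd length}\}$. A homomorphism $\xi:G\to H$ is a map $V(G)\to V(H)$ with $\xi[e]\in E(H)$ for every $e\in E(G)$; $\mathcal{H}_u(G,H)$ is the set of homomorphisms and $\mathcal{S}_u(G,H)=\mathcal{H}_u(G,H)\cap\mathcal{H}_u(G^*,H^*)$ the set of strict homomorphisms. Vertices $v\neq w$ are adjacent if $\{v,w\}\in E(G)$. For $X\subseteq V(G)$, $v\in X$, $\gamma_X(v)$ is the set of $w\in X$ with $w=v$ or connected to $v$ by a sequence $v=z_0,\dots,z_I=w$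 in $X$ with $z_{i-1},z_i$ adjacent; for a map $\xi$ on $V(G)$, $\Gamma_\xi(v)=\gamma_{\xi^{ -1}(\xi(v))}(v)$. For a class $\mathfrak{U}'$ with system of representatives $\mathfrak{U}'_r$ up to isomorphism, $R\sqsubseteq_\Gamma S$ with respect to $\mathfrak{U}'$ means that there exist injective maps $\rho_G:\mathcal{H}_u(G,R)\to\mathcal{H}_u(G,S)$, $G\in\mathfrak{U}'_r$, with $\Gamma_{\rho_G(\xi)}(v)=\Gamma_\xi(v)$ for all $G\in\mathfrak{U}'_r$, $\xi\in\mathcal{H}_u(G,R)$, $v\in V(G)$. -}

module Defs where

open import Data.Nat using (ℕ; zero; suc; _+_; _*_; _≤_)
open import Data.Fin using (Fin; zero; suc; inject₁; fromℕ; _≟_)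
open import Data.Fin.Properties using (all?)
open import Data.Bool using (Bool; T; T?)
open import Data.List using (List; []; _∷_; [_]; map; concatMap; filter; length)
open import Data.List using () renaming (allFin to allFinL)
open import Data.Product using (Σ; Σ-syntax; _×_; _,_)
open import Relation.Binary.PropositionalEquality using (_≡_; _≢_)
open import Relation.Nullary using (¬_; Dec)
open import Relation.Nullary.Decidable using (_→-dec_; _×-dec_; ¬?)
open import Function.Bundles using (_⇔_)

-- A finite undirected graph: non-empty vertex set Fin (suc n); the edge set is
-- encoded by a symmetric Boolean relation adj: for v ≢ w, adj v w = true iff
-- {v,w} is an edge; adj v v = true iff the loop {v} is an edge.
record Graph : Set where
  field
    n   : ℕ
    adj : Fin (suc n) → Fin (suc n) → Bool
    sym : ∀ v w → adj v w ≡ adj w v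

V : Graph → Set
V G = Fin (suc (Graph.n G))

Edge : (G : Graph) → V G → V G → Set
Edge G v w = T (Graph.adj G v w)

Adjacent : (G : Graph) → V G → V G → Set
Adjacent G v w = v ≢ w × Edge G v w

IsHom : (G H : Graph) → (V G → V H) → Set
IsHom G H ξ = ∀ v w → Edge G v w → Edge H (ξ v) (ξ w)

-- homomorphism G* → H* (loops removed)
IsHomStar : (G H : Graph) → (V G → V H) → Set
IsHomStar G H ξ = ∀ v w → Adjacent G v w → Adjacent H (ξ v) (ξ w)

IsStrictHom : (G H : Graph) → (V G → V H) → Set
IsStrictHom G H ξ = IsHom G H ξ × IsHomStar G H ξ

allFuns : (a b : ℕ) → List (Fin a → Fin b)
allFuns zero b = [ (λ ()) ]
allFuns (suc a) b =
  concatMap (λ f → map (λ i → cons i f) (allFinL b)) (allFuns a b)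
  where
  cons : Fin b → (Fin a → Fin b) → Fin (suc a) → Fin b
  cons i f zero = i
  cons i f (suc x) = f x

isHom? : (G H : Graph) → (ξ : V G → V H) → Dec (IsHom G H ξ)
isHom? G H ξ = all? λ v → all? λ w →
  T? (Graph.adj G v w) →-dec T? (Graph.adj H (ξ v) (ξ w))

isHomStar? : (G H : Graph) → (ξ : V G → V H) → Dec (IsHomStar G H ξ)
isHomStar? G H ξ = all? λ v → all? λ w →
  (¬? (v ≟ w) ×-dec T? (Graph.adj G v w)) →-dec
  (¬? (ξ v ≟ ξ w) ×-dec T? (Graph.adj H (ξ v) (ξ w)))

#Hom : Graph → Graph → ℕ
#Hom G H = length (filter (isHom? G H) (allFuns (suc (Graph.n G)) (suc (Graph.n H))))

#Strict : Graph → Graph → ℕ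
#Strict G H = length (filter (λ ξ → isHom? G H ξ ×-dec isHomStar? G H ξ)
                             (allFuns (suc (Graph.n G)) (suc (Graph.n H))))

-- G* contains a cycle of odd length 2k+3: injective closed walk c₀ … c_{2k+2} c₀
record OddCycle (G : Graph) : Set where
  field
    k    : ℕ
    c    : Fin (suc (2 + 2 * k)) → V G
    inj  : ∀ i j → c i ≡ c j → i ≡ j
    step : ∀ (i : Fin (2 + 2 * k)) → Adjacent G (c (inject₁ i)) (c (suc i))
    close : Adjacent G (c (fromℕ (2 + 2 * k))) (c zero)

InCo : Graph → Set
InCo G = ¬ OddCycle G

data InGamma (G : Graph) (X : V G → Set) (v : V G) : V G → Set where
  here : InGamma G X v v
  next : ∀ {u w} → InGamma G X v u → Adjacent G u w → X w → InGamma G X v w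

InΓ : (G H : Graph) → (V G → V H) → V G → V G → Set
InΓ G H ξ v = InGamma G (λ w → ξ w ≡ ξ v) v

record ΓMaps (G R S : Graph) : Set where
  field
    ρ      : (ξ : V G → V R) → IsHom G R ξ → V G → V S
    ρ-hom  : ∀ ξ h → IsHom G S (ρ ξ h)
    ρ-inj  : ∀ ξ₁ h₁ ξ₂ h₂ → (∀ v → ρ ξ₁ h₁ v ≡ ρ ξ₂ h₂ v) → ∀ v → ξ₁ v ≡ ξ₂ v
    ρ-Γ    : ∀ ξ h v w → InΓ G S (ρ ξ h) v w ⇔ InΓ G R ξ v w

_⊑Γ_wrt_ : Graph → Graph → (Graph → Set) → Set
R ⊑Γ S wrt U' = ∀ G → U' G → ΓMaps G R S

StrictLeq : (Graph → Set) → Graph → Graph → Set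
StrictLeq U' R S = ∀ G → U' G → #Strict G R ≤ #Strict G S

HomLeq : (Graph → Set) → Graph → Graph → Set
HomLeq U' R S = ∀ G → U' G → #Hom G R ≤ #Hom G S

-- If the ρ_G preserve Γ, they send strict homomorphisms to strict ones: an edge
-- v – w with ρ(ξ)(v) = ρ(ξ)(w) lies in a Γ_{ρ(ξ)} = Γ_ξ class, so ξ(v) = ξ(w),
-- which a strict ξ forbids. Injectivity of ρ_G then bounds both #S_u(G,R) and
-- #H_u(G,R); the last claim follows by passing through ⊑_Γ.
--
-- Conversely, a homomorphism ξ : G → R factors as ξ = η ∘ π, where π : G → G/Γ_ξ
-- contracts every Γ_ξ class and η is a strict homomorphism. Comparing the numbers
-- of strict homomorphisms out of G/Γ_ξ gives an injection ι into strict maps to S,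
-- and ρ(ξ) := ι(η) ∘ π has Γ_{ρ(ξ)} = Γ_ξ because ι(η) is strict. Since the
-- contraction depends only on the partition Γ_ξ, equal ρ(ξ) force equal Γ_ξ, equal
-- contractions and then equal η, hence equal ξ. When R has no odd cycle neither has
-- G/Γ_ξ: a strict homomorphism turns an odd cycle into an odd closed walk, and a
-- shortest odd closed walk is an odd cycle.

module Submission where

open import Defs
open import Data.Bool using (T; T?)
open import Data.Fin using (Fin; zero; suc; inject≤; inject₁; fromℕ; _≟_; cast)
open import Data.Fin.Properties using (injective⇒≤; inject≤-injective; cast-involutive; any?)
open import Data.List
  using (List; []; _∷_; _++_; filter; length; lookup; map; concatMap; allFin; cartesianProduct; tabulate)
open import Data.List.Properties using (filter-≐; length-++; length-tabulate)
open import Data.List.Membership.Propositional using (_∈_)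
open import Data.List.Membership.Propositional.Properties
  using (∈-allFin; ∈-filter⁺; ∈-filter⁻; ∈-cartesianProduct⁺; ∈-length; ∈-lookup; ∈-∃++)
import Data.List.Membership.Setoid as Membership
import Data.List.Membership.Setoid.Properties as Membershipₛ
open Membershipₛ using (index-injective; ∈-concatMap⁺; ∈-map⁺; ∈-map⁻; ∈-resp-≈)
open import Data.List.Relation.Binary.Disjoint.Setoid using (Disjoint)
import Data.List.Relation.Unary.All as All
import Data.List.Relation.Unary.All.Properties as Allₚ
open import Data.List.Relation.Unary.All.Properties using (all-filter; ¬Any⇒All¬)
import Data.List.Relation.Unary.AllPairs as AllPairs
open import Data.List.Relation.Unary.AllPairs using ([]; _∷_)
import Data.List.Relation.Unary.AllPairs.Properties as AllPairsₚ
import Data.List.Relation.Unary.Any as Any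
open import Data.List.Relation.Unary.Any using (here; there; index)
open import Data.List.Relation.Unary.Any.Properties using (lookup-index)
open import Data.List.Relation.Unary.Enumerates.Setoid using (IsEnumeration)
import Data.List.Relation.Unary.Unique.Propositional as UniqueP
import Data.List.Relation.Unary.Unique.Setoid as Unique
import Data.List.Relation.Unary.Unique.Setoid.Properties as Uniqueₚ
open import Data.Nat using (ℕ; zero; suc; pred; _+_; _*_; _≤_; _<_; z<s; >-nonZero; parity)
open import Data.Nat.Induction using (<-wellFounded)
open import Data.Nat.Properties using (suc-pred; *-suc; m<m+n; m<n+m)
open import Data.Nat.Tactic.RingSolver using (solve-∀)
open import Data.Parity.Base as ℙ using (0ℙ; 1ℙ)
open import Data.Parity.Properties using (+-homo-+; *-homo-*; suc-homo-⁻¹; ⁻¹-selfInverse)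
open import Data.Product using (Σ-syntax; _×_; _,_; proj₁; proj₂; uncurry)
open import Data.Sum using (_⊎_; inj₁; inj₂)
open import Function using (_∘_)
open import Function.Bundles using (_⇔_; mk⇔; Equivalence)
open import Induction.WellFounded using (Acc; acc)
open import Level using (0ℓ; _⊔_)
open import Relation.Binary.Bundles using (Setoid)
open import Relation.Binary.Construct.Closure.Equivalence using (EqClosure)
import Relation.Binary.Construct.Closure.Equivalence as EqClosure
open import Relation.Binary.Construct.Closure.ReflexiveTransitive using (ε; _◅◅_)
open import Relation.Binary.Core using (Rel)
open import Relation.Binary.Definitions using (DecidableEquality; _Respects_) renaming (Decidable to Decidable₂)
open import Relation.Binary.PropositionalEquality
  using ( _≡_; _≢_; _≗_; refl; sym; trans; cong; subst; subst₂; _→-setoid_; setoid; isEquivalence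
        ; module ≡-Reasoning)
open import Relation.Binary.Structures using (IsEquivalence)
open import Relation.Nullary using (¬_; Dec; yes; no; contradiction; ¬?)
open import Relation.Nullary.Decidable using (_×-dec_; ⌊_⌋; isYes≗does; does-⇔; toWitness; fromWitness)
open import Relation.Unary using (Pred; Decidable)

-- Counting through injections

module _ {c ℓ} (S : Setoid c ℓ) where
  open Setoid S using (_≈_) renaming (sym to ≈-sym)
  open Unique S

  lookup-injective : ∀ {xs} → Unique xs → ∀ i j → lookup xs i ≈ lookup xs j → i ≡ j
  lookup-injective (_ ∷ _) zero zero _ = refl
  lookup-injective (x≉ ∷ _) zero (suc j) x≈ = contradiction x≈ (All.lookup x≉ (∈-lookup j))
  lookup-injective (x≉ ∷ _) (suc i) zero ≈x = contradiction (≈-sym ≈x) (All.lookup x≉ (∈-lookup i))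
  lookup-injective (_ ∷ u) (suc i) (suc j) eq = cong suc (lookup-injective u i j eq)

module Counting {c₁ ℓ₁ c₂ ℓ₂} (S₁ : Setoid c₁ ℓ₁) (S₂ : Setoid c₂ ℓ₂) where
  open Setoid S₁ using () renaming (Carrier to A; _≈_ to _≈₁_)
  open Setoid S₂ using () renaming (Carrier to B; _≈_ to _≈₂_)

  record Injection {p q} (P : Pred A p) (Q : Pred B q) : Set (c₁ ⊔ ℓ₁ ⊔ c₂ ⊔ ℓ₂ ⊔ p ⊔ q) where
    field
      to           : ∀ x → P x → B
      to-Q         : ∀ x px → Q (to x px)
      to-injective : ∀ x px y py → to x px ≈₂ to y py → x ≈₁ y

  module _ {p q} {P : Pred A p} {Q : Pred B q} (P? : Decidable P) (Q? : Decidable Q) where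

    length-filter-≤ : ∀ {xs ys} → Unique.Unique S₁ xs → IsEnumeration S₂ ys → Q Respects _≈₂_ →
                      Injection P Q → length (filter P? xs) ≤ length (filter Q? ys)
    length-filter-≤ {xs} {ys} xs! ys-all Q-resp f = injective⇒≤ {f = position} position-injective
      where
      open Injection f
      image : (i : Fin (length (filter P? xs))) → B
      image i = to _ (All.lookup (all-filter P? xs) (∈-lookup i))
      image∈ : ∀ i → Membership._∈_ S₂ (image i) (filter Q? ys)
      image∈ i = Membershipₛ.∈-filter⁺ S₂ Q? Q-resp (ys-all (image i)) (to-Q _ _)
      position : Fin (length (filter P? xs)) → Fin (length (filter Q? ys))
      position i = index (image∈ i)
      position-injective : ∀ {i j} → position i ≡ position j → i ≡ j
      position-injective {i} {j} eq = lookup-injective S₁ (Uniqueₚ.filter⁺ S₁ P? xs!) i j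
        (to-injective _ _ _ _ (index-injective S₂ (image∈ i) (image∈ j) eq))

    injection-of-length-≤ : ∀ {xs ys} → IsEnumeration S₁ xs → Unique.Unique S₂ ys → P Respects _≈₁_ →
                            length (filter P? xs) ≤ length (filter Q? ys) → Injection P Q
    injection-of-length-≤ {xs} {ys} xs-all ys! P-resp le = record
      { to = λ x px → lookup (filter Q? ys) (slot x px)
      ; to-Q = λ x px → All.lookup (all-filter Q? ys) (∈-lookup (slot x px))
      ; to-injective = λ x px y py eq → index-injective S₁ (position x px) (position y py)
          (inject≤-injective le le _ _ (lookup-injective S₂ (Uniqueₚ.filter⁺ S₂ Q? ys!) _ _ eq))
      }
      where
      position : ∀ x → P x → Membership._∈_ S₁ x (filter P? xs)
      position x px = Membershipₛ.∈-filter⁺ S₁ P? P-resp (xs-all x) px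
      slot : ∀ x → P x → Fin (length (filter Q? ys))
      slot x px = inject≤ (index (position x px)) le

module _ {a b : ℕ} (extend : Fin b → (Fin a → Fin b) → Fin (suc a) → Fin b)
         (extend-zero : ∀ i f → extend i f zero ≡ i)
         (extend-suc : ∀ i f x → extend i f (suc x) ≡ f x) where
  private
    Fᵃ = Fin a →-setoid Fin b
    Fᵃ⁺¹ = Fin (suc a) →-setoid Fin b

    extensions : (Fin a → Fin b) → List (Fin (suc a) → Fin b)
    extensions f = map (λ i → extend i f) (allFin b)

  extensions-enumerates : ∀ {fs} → IsEnumeration Fᵃ fs → IsEnumeration Fᵃ⁺¹ (concatMap extensions fs)
  extensions-enumerates {fs} fs-all f = ∈-concatMap⁺ Fᵃ Fᵃ⁺¹ (Any.map extends (fs-all (λ x → f (suc x))))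
    where
    extends : ∀ {g} → (λ x → f (suc x)) ≗ g → Membership._∈_ Fᵃ⁺¹ f (extensions g)
    extends {g} f∘suc≗g =
      ∈-resp-≈ Fᵃ⁺¹ f≗ (∈-map⁺ (setoid (Fin b)) Fᵃ⁺¹ (λ { refl _ → refl }) (∈-allFin (f zero)))
      where
      f≗ : extend (f zero) g ≗ f
      f≗ zero = extend-zero (f zero) g
      f≗ (suc x) = trans (extend-suc (f zero) g x) (sym (f∘suc≗g x))

  extensions-unique : ∀ {fs} → Unique.Unique Fᵃ fs → Unique.Unique Fᵃ⁺¹ (concatMap extensions fs)
  extensions-unique fs! = Uniqueₚ.concat⁺ Fᵃ⁺¹ (Allₚ.map⁺ (All.universal (λ _ → block-unique) _))
                                             (AllPairsₚ.map⁺ (AllPairs.map blocks-disjoint fs!))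
    where
    block-unique : ∀ {f} → Unique.Unique Fᵃ⁺¹ (extensions f)
    block-unique {f} = Uniqueₚ.map⁺ (setoid (Fin b)) Fᵃ⁺¹
      (λ {i} {j} eq → trans (sym (extend-zero i f)) (trans (eq zero) (extend-zero j f)))
      (Uniqueₚ.tabulate⁺ (setoid (Fin b)) (λ eq → eq))
    blocks-disjoint : ∀ {f g} → ¬ f ≗ g → Disjoint Fᵃ⁺¹ (extensions f) (extensions g)
    blocks-disjoint {f} {g} f≉g (h∈f , h∈g)
      with ∈-map⁻ (setoid (Fin b)) Fᵃ⁺¹ h∈f | ∈-map⁻ (setoid (Fin b)) Fᵃ⁺¹ h∈g
    ... | i , _ , h≗f | j , _ , h≗g = f≉g (λ x →
      trans (sym (extend-suc i f x)) (trans (sym (h≗f (suc x))) (trans (h≗g (suc x)) (extend-suc j g x))))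

allFuns-enumerates : ∀ a b → IsEnumeration (Fin a →-setoid Fin b) (allFuns a b)
allFuns-enumerates zero b f = Any.here (λ ())
allFuns-enumerates (suc a) b = extensions-enumerates _ (λ _ _ → refl) (λ _ _ _ → refl) (allFuns-enumerates a b)

allFuns-unique : ∀ a b → Unique.Unique (Fin a →-setoid Fin b) (allFuns a b)
allFuns-unique zero b = All.[] ∷ []
allFuns-unique (suc a) b = extensions-unique _ (λ _ _ → refl) (λ _ _ _ → refl) (allFuns-unique a b)

-- Canonical labels for an equivalence closure

Linked : ∀ {a} {A : Set a} → List (A × A) → Rel A a
Linked ps = EqClosure (λ x y → (x , y) ∈ ps)

module Labelling {a} {A : Set a} (_≟_ : DecidableEquality A) where
  open ≡-Reasoning

  relabel : A → A → A → A
  relabel old new v with v ≟ old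
  ... | yes _ = new
  ... | no  _ = v

  relabel-old : ∀ {old new v} → v ≡ old → relabel old new v ≡ new
  relabel-old {old} {new} {v} v≡old with v ≟ old
  ... | yes _    = refl
  ... | no  v≢old = contradiction v≡old v≢old

  relabel-other : ∀ {old new v} → v ≢ old → relabel old new v ≡ v
  relabel-other {old} {new} {v} v≢old with v ≟ old
  ... | yes v≡old = contradiction v≡old v≢old
  ... | no  _     = refl

  relabel-new : ∀ old new → relabel old new new ≡ new
  relabel-new old new with new ≟ old
  ... | yes _ = refl
  ... | no  _ = refl

  label : List (A × A) → A → A
  label [] v = v
  label ((x , y) ∷ ps) v = relabel (label ps x) (label ps y) (label ps v)

  label-idempotent : ∀ ps v → label ps (label ps v) ≡ label ps v
  label-idempotent [] v = refl
  label-idempotent ((x , y) ∷ ps) v = case (label ps v ≟ label ps x)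
    where
    ℓ = label ps
    merge = relabel (ℓ x) (ℓ y)
    case : Dec (ℓ v ≡ ℓ x) → merge (ℓ (merge (ℓ v))) ≡ merge (ℓ v)
    case (yes v~x) = begin
      merge (ℓ (merge (ℓ v)))  ≡⟨ cong (merge ∘ ℓ) (relabel-old v~x) ⟩
      merge (ℓ (ℓ y))          ≡⟨ cong merge (label-idempotent ps y) ⟩
      merge (ℓ y)              ≡⟨ relabel-new (ℓ x) (ℓ y) ⟩
      ℓ y                      ≡⟨ relabel-old v~x ⟨
      merge (ℓ v)              ∎
    case (no v≁x) = cong merge (trans (cong ℓ (relabel-other v≁x)) (label-idempotent ps v))

  label-respects-pairs : ∀ ps {x y} → (x , y) ∈ ps → label ps x ≡ label ps y
  label-respects-pairs ((x , y) ∷ ps) (here refl) =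
    trans (relabel-old refl) (sym (relabel-new (label ps x) (label ps y)))
  label-respects-pairs (_ ∷ ps) (there p) = cong (relabel _ _) (label-respects-pairs ps p)

  linked⇒label≡ : ∀ ps {x y} → Linked ps x y → label ps x ≡ label ps y
  linked⇒label≡ ps = EqClosure.gfold isEquivalence (label ps) (label-respects-pairs ps)

  label≡⇒linked : ∀ ps {x y} → label ps x ≡ label ps y → Linked ps x y
  label≡⇒linked [] refl = ε
  label≡⇒linked ((x , y) ∷ ps) {u} {w} eq = case (ℓ u ≟ ℓ x) (ℓ w ≟ ℓ x)
    where
    ℓ = label ps
    within : ∀ {u w} → ℓ u ≡ ℓ w → Linked ((x , y) ∷ ps) u w
    within eq = EqClosure.map there (label≡⇒linked ps eq)
    x~y : Linked ((x , y) ∷ ps) x y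
    x~y = EqClosure.return (here refl)
    case : Dec (ℓ u ≡ ℓ x) → Dec (ℓ w ≡ ℓ x) → Linked ((x , y) ∷ ps) u w
    case (yes u~x) (yes w~x) = within (trans u~x (sym w~x))
    case (yes u~x) (no w≁x) =
      within u~x ◅◅ x~y ◅◅ within (trans (sym (relabel-old u~x)) (trans eq (relabel-other w≁x)))
    case (no u≁x) (yes w~x) = EqClosure.symmetric _
      (within w~x ◅◅ x~y ◅◅ within (trans (sym (relabel-old w~x)) (trans (sym eq) (relabel-other u≁x))))
    case (no u≁x) (no w≁x) = within (trans (sym (relabel-other u≁x)) (trans eq (relabel-other w≁x)))

-- The partition Γ_ξ

edge-sym : ∀ {G : Graph} {v w} → Edge G v w → Edge G w v
edge-sym {G} {v} {w} = subst T (Graph.sym G v w)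

adjacent-sym : ∀ {G : Graph} {v w} → Adjacent G v w → Adjacent G w v
adjacent-sym {G} (v≢w , e) = (λ w≡v → v≢w (sym w≡v)) , edge-sym {G} e

adjacent? : (G : Graph) → Decidable₂ (Adjacent G)
adjacent? G v w = ¬? (v ≟ w) ×-dec T? (Graph.adj G v w)

SameColour : (G H : Graph) → (V G → V H) → Rel (V G) 0ℓ
SameColour G H ξ u w = Adjacent G u w × ξ u ≡ ξ w

module _ {G H : Graph} {ξ : V G → V H} where

  Γ-colour : ∀ {v w} → InΓ G H ξ v w → ξ w ≡ ξ v
  Γ-colour here = refl
  Γ-colour (next _ _ ξw≡ξv) = ξw≡ξv

  Γ-trans : ∀ {u v w} → InΓ G H ξ u v → InΓ G H ξ v w → InΓ G H ξ u w
  Γ-trans u~v here = u~v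
  Γ-trans u~v (next v~x x-w ξw≡ξv) = next (Γ-trans u~v v~x) x-w (trans ξw≡ξv (Γ-colour u~v))

  Γ-step : ∀ {v w} → SameColour G H ξ v w → InΓ G H ξ v w
  Γ-step (v-w , ξv≡ξw) = next here v-w (sym ξv≡ξw)

  Γ-sym : ∀ {v w} → InΓ G H ξ v w → InΓ G H ξ w v
  Γ-sym here = here
  Γ-sym (next v~x x-w ξw≡ξv) =
    Γ-trans (Γ-step (adjacent-sym {G} x-w , trans ξw≡ξv (sym (Γ-colour v~x)))) (Γ-sym v~x)

  Γ-isEquivalence : IsEquivalence (InΓ G H ξ)
  Γ-isEquivalence = record { refl = here ; sym = Γ-sym ; trans = Γ-trans }

  Γ⇔closure : ∀ {v w} → InΓ G H ξ v w ⇔ EqClosure (SameColour G H ξ) v w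
  Γ⇔closure = mk⇔ to (EqClosure.fold Γ-isEquivalence Γ-step)
    where
    to : ∀ {v w} → InΓ G H ξ v w → EqClosure (SameColour G H ξ) v w
    to here = ε
    to (next v~x x-w ξw≡ξv) = to v~x ◅◅ EqClosure.return (x-w , trans (Γ-colour v~x) (sym ξw≡ξv))

Γ-mono : ∀ {G H K : Graph} {θ : V G → V H} {ξ : V G → V K} →
         (∀ {u w} → SameColour G H θ u w → ξ u ≡ ξ w) → ∀ {v w} → InΓ G H θ v w → InΓ G K ξ v w
Γ-mono {G} {H} {K} {θ} {ξ} θ⇒ξ v~w =
  Equivalence.from (Γ⇔closure {G} {K} {ξ})
    (EqClosure.map (λ c → proj₁ c , θ⇒ξ c) (Equivalence.to (Γ⇔closure {G} {H} {θ}) v~w))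

Γ-resp-≗ : ∀ {G H : Graph} {f g : V G → V H} → f ≗ g → ∀ {v w} → InΓ G H f v w → InΓ G H g v w
Γ-resp-≗ {G} {H} {f} {g} f≗g =
  Γ-mono {G} {H} {H} {f} {g} (λ (_ , fu≡fw) → trans (sym (f≗g _)) (trans fu≡fw (f≗g _)))

vertexPairs : (G : Graph) → List (V G × V G)
vertexPairs G = cartesianProduct (allFin _) (allFin _)

sameColour? : (G H : Graph) (ξ : V G → V H) → Decidable (uncurry (SameColour G H ξ))
sameColour? G H ξ (u , w) = adjacent? G u w ×-dec (ξ u ≟ ξ w)

-- The contraction G / Γ_ξ is computed from this list rather than from ξ, so that maps
-- with the same partition Γ_ξ yield literally the same graph (monochromatic-cong).
monochromatic : (G H : Graph) → (V G → V H) → List (V G × V G)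
monochromatic G H ξ = filter (sameColour? G H ξ) (vertexPairs G)

Generates : (G H : Graph) → List (V G × V G) → (V G → V H) → Set
Generates G H ps ξ = ∀ {v w} → Linked ps v w ⇔ InΓ G H ξ v w

module _ {G H : Graph} {ξ : V G → V H} where

  ∈-monochromatic⇔ : ∀ {u w} → (u , w) ∈ monochromatic G H ξ ⇔ SameColour G H ξ u w
  ∈-monochromatic⇔ {u} {w} = mk⇔
    (λ p → proj₂ (∈-filter⁻ (sameColour? G H ξ) {xs = vertexPairs G} p))
    (∈-filter⁺ (sameColour? G H ξ) (∈-cartesianProduct⁺ (∈-allFin u) (∈-allFin w)))

  monochromatic-generates : Generates G H (monochromatic G H ξ) ξ
  monochromatic-generates = mk⇔
    (Equivalence.from (Γ⇔closure {G} {H} {ξ}) ∘ EqClosure.map (Equivalence.to ∈-monochromatic⇔))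
    (EqClosure.map (Equivalence.from ∈-monochromatic⇔) ∘ Equivalence.to (Γ⇔closure {G} {H} {ξ}))

monochromatic-cong : ∀ {G H : Graph} {ξ₁ ξ₂ : V G → V H} →
                     (∀ {v w} → InΓ G H ξ₁ v w ⇔ InΓ G H ξ₂ v w) →
                     monochromatic G H ξ₁ ≡ monochromatic G H ξ₂
monochromatic-cong {G} {H} {ξ₁} {ξ₂} Γ₁⇔Γ₂ =
  filter-≐ (sameColour? G H ξ₁) (sameColour? G H ξ₂)
    (recolour (Equivalence.to Γ₁⇔Γ₂) , recolour (Equivalence.from Γ₁⇔Γ₂)) (vertexPairs G)
  where
  recolour : ∀ {θ η : V G → V H} → (∀ {v w} → InΓ G H θ v w → InΓ G H η v w) →
             ∀ {p} → SameColour G H θ (proj₁ p) (proj₂ p) → SameColour G H η (proj₁ p) (proj₂ p)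
  recolour {θ} {η} θ⊆η (u-w , θu≡θw) =
    u-w , sym (Γ-colour {G} {H} {η} (θ⊆η (Γ-step {G} {H} {θ} (u-w , θu≡θw))))

-- Contraction along a list of vertex pairs

module Contraction (G : Graph) (ps : List (V G × V G)) where
  open Labelling (_≟_ {suc (Graph.n G)})

  isRoot? : Decidable (λ v → label ps v ≡ v)
  isRoot? v = label ps v ≟ v

  roots : List (V G)
  roots = filter isRoot? (allFin _)

  label∈roots : ∀ v → label ps v ∈ roots
  label∈roots v = ∈-filter⁺ isRoot? (∈-allFin (label ps v)) (label-idempotent ps v)

  roots-nonempty : suc (pred (length roots)) ≡ length roots
  roots-nonempty = suc-pred (length roots) {{>-nonZero (∈-length (label∈roots zero))}}

  Vertex : Set
  Vertex = Fin (suc (pred (length roots)))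

  root : Vertex → V G
  root i = lookup roots (cast roots-nonempty i)

  project : V G → Vertex
  project v = cast (sym roots-nonempty) (index (label∈roots v))

  root-project : ∀ v → root (project v) ≡ label ps v
  root-project v = trans (cong (lookup roots) (cast-involutive roots-nonempty (sym roots-nonempty) _))
                         (sym (lookup-index (label∈roots v)))

  root-isRoot : ∀ i → label ps (root i) ≡ root i
  root-isRoot i = All.lookup (all-filter isRoot? (allFin _)) (∈-lookup (cast roots-nonempty i))

  root-injective : ∀ {i j} → root i ≡ root j → i ≡ j
  root-injective {i} {j} eq = begin
    i                                                   ≡⟨ cast-involutive (sym roots-nonempty) roots-nonempty i ⟨
    cast (sym roots-nonempty) (cast roots-nonempty i)   ≡⟨ cong (cast (sym roots-nonempty)) roots-lookup-injective ⟩
    cast (sym roots-nonempty) (cast roots-nonempty j)   ≡⟨ cast-involutive (sym roots-nonempty) roots-nonempty j ⟩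
    j                                                   ∎
    where
    open ≡-Reasoning
    roots-lookup-injective : cast roots-nonempty i ≡ cast roots-nonempty j
    roots-lookup-injective = lookup-injective (setoid (V G))
      (Uniqueₚ.filter⁺ (setoid (V G)) isRoot? (Uniqueₚ.tabulate⁺ (setoid (V G)) (λ eq → eq))) _ _ eq

  project-root : ∀ i → project (root i) ≡ i
  project-root i = root-injective (trans (root-project (root i)) (root-isRoot i))

  linked⇔project≡ : ∀ {u w} → Linked ps u w ⇔ project u ≡ project w
  linked⇔project≡ {u} {w} = mk⇔
    (λ u~w → root-injective (trans (root-project u) (trans (linked⇒label≡ ps u~w) (sym (root-project w)))))
    (λ πu≡πw → label≡⇒linked ps (trans (sym (root-project u)) (trans (cong root πu≡πw) (root-project w))))

  linked-label : ∀ v → Linked ps (label ps v) v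
  linked-label v = label≡⇒linked ps (label-idempotent ps v)

  Joined : Vertex → Vertex → Set
  Joined i j = Σ[ u ∈ V G ] Σ[ w ∈ V G ] project u ≡ i × project w ≡ j × Edge G u w

  joined? : Decidable₂ Joined
  joined? i j = any? λ u → any? λ w → (project u ≟ i) ×-dec ((project w ≟ j) ×-dec T? (Graph.adj G u w))

  joined-sym : ∀ {i j} → Joined i j → Joined j i
  joined-sym (u , w , πu≡i , πw≡j , e) = w , u , πw≡j , πu≡i , edge-sym {G} e

  quotient : Graph
  quotient = record
    { n = pred (length roots)
    ; adj = λ i j → ⌊ joined? i j ⌋
    ; sym = λ i j → trans (isYes≗does (joined? i j))
                    (trans (does-⇔ (mk⇔ joined-sym joined-sym) (joined? i j) (joined? j i))
                           (sym (isYes≗does (joined? j i))))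
    }

  project-hom : IsHom G quotient project
  project-hom u w e = fromWitness {a? = joined? (project u) (project w)} (u , w , refl , refl , e)

  module _ {R : Graph} {ξ : V G → V R} (generates : Generates G R ps ξ) where

    linked⇒colour≡ : ∀ {u w} → Linked ps u w → ξ u ≡ ξ w
    linked⇒colour≡ u~w = sym (Γ-colour {G} {R} {ξ} (Equivalence.to generates u~w))

    sameColour⇒linked : ∀ {u w} → SameColour G R ξ u w → Linked ps u w
    sameColour⇒linked u-w = Equivalence.from generates (Γ-step {G} {R} {ξ} u-w)

    descend-project : ∀ v → ξ (root (project v)) ≡ ξ v
    descend-project v = trans (cong ξ (root-project v)) (linked⇒colour≡ (linked-label v))

    descend-strict : IsHom G R ξ → IsStrictHom quotient R (ξ ∘ root)
    descend-strict ξ-hom = descend-hom , descend-star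
      where
      descend-edge : ∀ {i j} → Joined i j → Edge R (ξ (root i)) (ξ (root j))
      descend-edge (u , w , refl , refl , e) =
        subst₂ (Edge R) (sym (descend-project u)) (sym (descend-project w)) (ξ-hom u w e)

      descend-hom : IsHom quotient R (ξ ∘ root)
      descend-hom i j e = descend-edge (toWitness {a? = joined? i j} e)

      separated : ∀ {i j} → i ≢ j → Joined i j → ξ (root i) ≢ ξ (root j)
      separated i≢j (u , w , refl , refl , e) ξi≡ξj =
        i≢j (Equivalence.to linked⇔project≡ (sameColour⇒linked ((u≢w , e) , ξu≡ξw)))
        where
        u≢w : u ≢ w
        u≢w refl = i≢j refl
        ξu≡ξw : ξ u ≡ ξ w
        ξu≡ξw = trans (sym (descend-project u)) (trans ξi≡ξj (descend-project w))

      descend-star : IsHomStar quotient R (ξ ∘ root)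
      descend-star i j (i≢j , e) = separated i≢j (toWitness {a? = joined? i j} e) , descend-hom i j e

  lift-collapse : ∀ {S : Graph} {θ : V quotient → V S} → IsHomStar quotient S θ →
                  ∀ {u w} → SameColour G S (θ ∘ project) u w → Linked ps u w
  lift-collapse {θ = θ} θ-star {u} {w} (u-w , θπu≡θπw) with project u ≟ project w
  ... | yes πu≡πw = Equivalence.from linked⇔project≡ πu≡πw
  ... | no  πu≢πw = contradiction θπu≡θπw (proj₁ (θ-star _ _ (πu≢πw , project-hom u w (proj₂ u-w))))

_/_ : (G : Graph) → List (V G × V G) → Graph
G / ps = Contraction.quotient G ps

-- Odd closed walks contain odd cycles

module _ {a} {A : Set a} (_≟_ : DecidableEquality A) where

  Duplicated : List A → Set a
  Duplicated vs = Σ[ as ∈ List A ] Σ[ y ∈ A ] Σ[ bs ∈ List A ] Σ[ cs ∈ List A ] vs ≡ as ++ y ∷ bs ++ y ∷ cs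

  unique-or-duplicated : (vs : List A) → UniqueP.Unique vs ⊎ Duplicated vs
  unique-or-duplicated [] = inj₁ []
  unique-or-duplicated (v ∷ vs) with unique-or-duplicated vs
  ... | inj₂ (as , y , bs , cs , eq) = inj₂ (v ∷ as , y , bs , cs , cong (v ∷_) eq)
  ... | inj₁ vs! with Any.any? (v ≟_) vs
  ...   | yes v∈vs = let bs , cs , eq = ∈-∃++ v∈vs in inj₂ ([] , v , bs , cs , cong (v ∷_) eq)
  ...   | no  v∉vs = inj₁ (¬Any⇒All¬ vs v∉vs ∷ vs!)

parity-+-odd : ∀ m n → parity (m + n) ≡ 1ℙ → parity m ≡ 1ℙ ⊎ parity n ≡ 1ℙ
parity-+-odd m n odd with parity m in eq
... | 1ℙ = inj₁ refl
... | 0ℙ = inj₂ (trans (sym (trans (+-homo-+ m n) (cong (ℙ._+ parity n) eq))) odd)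

even-positive : ∀ n → parity n ≡ 0ℙ → n ≢ 0 → Σ[ k ∈ ℕ ] n ≡ 2 + 2 * k
even-positive 0 _ n≢0 = contradiction refl n≢0
even-positive 2 _ _ = 0 , refl
even-positive (suc (suc (suc n))) even _ =
  let k , eq = even-positive (suc n) even (λ ()) in suc k , cong (2 +_) (trans eq (sym (*-suc 2 k)))

parity-suc-double : ∀ k → parity (suc (2 * k)) ≡ 1ℙ
parity-suc-double k = sym (⁻¹-selfInverse (trans (suc-homo-⁻¹ (2 * k)) (*-homo-* 2 k)))

module Walks (H : Graph) where

  Walk : V H → List (V H) → V H → Set
  Walk x [] z = Adjacent H x z
  Walk x (v ∷ vs) z = Adjacent H x v × Walk v vs z

  walk-++⁻ : ∀ {x y z} us {vs} → Walk x (us ++ y ∷ vs) z → Walk x us y × Walk y vs z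
  walk-++⁻ [] (x-y , y⋯z) = x-y , y⋯z
  walk-++⁻ (u ∷ us) (x-u , u⋯z) = let u⋯y , y⋯z = walk-++⁻ us u⋯z in (x-u , u⋯y) , y⋯z

  walk-++⁺ : ∀ {x y z} us {vs} → Walk x us y → Walk y vs z → Walk x (us ++ y ∷ vs) z
  walk-++⁺ [] x-y y⋯z = x-y , y⋯z
  walk-++⁺ (u ∷ us) (x-u , u⋯y) y⋯z = x-u , walk-++⁺ us u⋯y y⋯z

  walk-step : ∀ {x z} vs → Walk x vs z → ∀ i → Adjacent H (lookup (x ∷ vs) (inject₁ i)) (lookup vs i)
  walk-step (v ∷ vs) (x-v , _) zero = x-v
  walk-step (v ∷ vs) (_ , v⋯z) (suc i) = walk-step vs v⋯z i

  walk-last : ∀ {x z} vs → Walk x vs z → Adjacent H (lookup (x ∷ vs) (fromℕ (length vs))) z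
  walk-last [] x-z = x-z
  walk-last (v ∷ vs) (_ , v⋯z) = walk-last vs v⋯z

  walk-tabulate : ∀ m (c : Fin (suc m) → V H) {z} → (∀ i → Adjacent H (c (inject₁ i)) (c (suc i))) →
                  Adjacent H (c (fromℕ m)) z → Walk (c zero) (tabulate (c ∘ suc)) z
  walk-tabulate zero c _ last = last
  walk-tabulate (suc m) c steps last = steps zero , walk-tabulate m (c ∘ suc) (steps ∘ suc) last

  record ClosedWalk : Set where
    constructor closedWalk
    field
      start : V H
      via   : List (V H)
      walk  : Walk start via start

    size : ℕ
    size = suc (length via)

  open ClosedWalk

  record Cycle (m : ℕ) : Set where
    field
      c     : Fin (suc m) → V H
      inj   : ∀ i j → c i ≡ c j → i ≡ j
      step  : ∀ (i : Fin m) → Adjacent H (c (inject₁ i)) (c (suc i))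
      close : Adjacent H (c (fromℕ m)) (c zero)

  cycle-of-unique : (W : ClosedWalk) → UniqueP.Unique (start W ∷ via W) → Cycle (length (via W))
  cycle-of-unique (closedWalk x vs x⋯x) unique = record
    { c = lookup (x ∷ vs)
    ; inj = lookup-injective (setoid (V H)) unique
    ; step = walk-step vs x⋯x
    ; close = walk-last vs x⋯x
    }

  via-nonempty : (W : ClosedWalk) → length (via W) ≢ 0
  via-nonempty (closedWalk x [] (x≢x , _)) _ = x≢x refl

  oddCycle-of-cycle : ∀ k → Cycle (2 + 2 * k) → OddCycle H
  oddCycle-of-cycle k C = record { k = k ; c = c ; inj = inj ; step = step ; close = close }
    where open Cycle C

  split : (W : ClosedWalk) → Duplicated _≟_ (start W ∷ via W) →
          Σ[ W₁ ∈ ClosedWalk ] Σ[ W₂ ∈ ClosedWalk ] size W₁ + size W₂ ≡ size W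
  split (closedWalk x vs x⋯x) ([] , .x , bs , cs , refl) =
    let x⋯x₁ , x⋯x₂ = walk-++⁻ bs x⋯x
    in closedWalk x bs x⋯x₁ , closedWalk x cs x⋯x₂ , cong suc (sym (length-++ bs))
  split (closedWalk x vs x⋯x) (.x ∷ as , y , bs , cs , refl) =
    let x⋯y , y⋯x = walk-++⁻ as x⋯x
        y⋯y , y⋯x′ = walk-++⁻ bs y⋯x
    in closedWalk y bs y⋯y , closedWalk x (as ++ y ∷ cs) (walk-++⁺ as x⋯y y⋯x′) , sizes
    where
    sizes : suc (length bs) + suc (length (as ++ y ∷ cs)) ≡ suc (length (as ++ y ∷ bs ++ y ∷ cs))
    sizes = begin
      suc (length bs + suc (length (as ++ y ∷ cs)))  ≡⟨ cong (λ n → suc (length bs + suc n)) (length-++ as) ⟩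
      suc (length bs + suc (a + suc c))              ≡⟨ cong suc (+-interchange a (length bs) c) ⟩
      suc (a + suc (length bs + suc c))              ≡⟨ cong (λ n → suc (a + suc n)) (length-++ bs) ⟨
      suc (a + suc (length (bs ++ y ∷ cs)))          ≡⟨ cong suc (length-++ as) ⟨
      suc (length (as ++ y ∷ bs ++ y ∷ cs))          ∎
      where
      open ≡-Reasoning
      a = length as
      c = length cs
      +-interchange : ∀ a b c → b + suc (a + suc c) ≡ a + suc (b + suc c)
      +-interchange = solve-∀

  oddCycle-of-oddClosedWalk : (W : ClosedWalk) → parity (size W) ≡ 1ℙ → OddCycle H
  oddCycle-of-oddClosedWalk W = go W (<-wellFounded (size W))
    where
    go : (W : ClosedWalk) → Acc _<_ (size W) → parity (size W) ≡ 1ℙ → OddCycle H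
    go W (acc smaller) odd with unique-or-duplicated _≟_ (start W ∷ via W)
    ... | inj₁ unique =
      let k , len = even-positive (length (via W)) even (via-nonempty W)
      in oddCycle-of-cycle k (subst Cycle len (cycle-of-unique W unique))
      where
      even : parity (length (via W)) ≡ 0ℙ
      even = trans (sym (suc-homo-⁻¹ (length (via W)))) (cong ℙ._⁻¹ odd)
    ... | inj₂ duplicated with split W duplicated
    ...   | W₁ , W₂ , sum with parity-+-odd (size W₁) (size W₂) (trans (cong parity sum) odd)
    ...     | inj₁ odd₁ = go W₁ (smaller (subst (size W₁ <_) sum (m<m+n (size W₁) z<s))) odd₁
    ...     | inj₂ odd₂ = go W₂ (smaller (subst (size W₂ <_) sum (m<n+m (size W₂) z<s))) odd₂

oddCycle-map : ∀ {G H : Graph} {η : V G → V H} → IsHomStar G H η → OddCycle G → OddCycle H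
oddCycle-map {G} {H} {η} η-star C =
  oddCycle-of-oddClosedWalk (closedWalk (η (c zero)) (tabulate (η ∘ c ∘ suc)) walk) odd
  where
  open OddCycle C
  open Walks H
  walk : Walk (η (c zero)) (tabulate (η ∘ c ∘ suc)) (η (c zero))
  walk = walk-tabulate (2 + 2 * k) (η ∘ c) (λ i → η-star _ _ (step i)) (η-star _ _ close)
  odd : parity (suc (length (tabulate (η ∘ c ∘ suc)))) ≡ 1ℙ
  odd = trans (cong (parity ∘ suc) (length-tabulate (η ∘ c ∘ suc))) (parity-suc-double k)

InCo-reflect : ∀ {G H : Graph} {η : V G → V H} → IsHomStar G H η → InCo H → InCo G
InCo-reflect η-star H-bipartite = H-bipartite ∘ oddCycle-map η-star

-- Γ-preserving injections versus counts of strict homomorphisms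

strict? : (G H : Graph) → Decidable (IsStrictHom G H)
strict? G H ξ = isHom? G H ξ ×-dec isHomStar? G H ξ

hom-resp-≗ : ∀ {G H : Graph} → IsHom G H Respects _≗_
hom-resp-≗ {G} {H} f≗g f-hom v w e = subst₂ (Edge H) (f≗g v) (f≗g w) (f-hom v w e)

strict-resp-≗ : ∀ {G H : Graph} → IsStrictHom G H Respects _≗_
strict-resp-≗ {G} {H} f≗g (f-hom , f-star) = hom-resp-≗ {G} {H} f≗g f-hom , λ v w v-w →
  let fv≢fw , e = f-star v w v-w
  in (λ gv≡gw → fv≢fw (trans (f≗g v) (trans gv≡gw (sym (f≗g w))))) , subst₂ (Edge H) (f≗g v) (f≗g w) e

module _ {G R S : Graph} where
  open Counting (V G →-setoid V R) (V G →-setoid V S)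

  strict-count-≤ : Injection (IsStrictHom G R) (IsStrictHom G S) → #Strict G R ≤ #Strict G S
  strict-count-≤ = length-filter-≤ (strict? G R) (strict? G S)
    (allFuns-unique _ _) (allFuns-enumerates _ _) (strict-resp-≗ {G} {S})

  hom-count-≤ : Injection (IsHom G R) (IsHom G S) → #Hom G R ≤ #Hom G S
  hom-count-≤ = length-filter-≤ (isHom? G R) (isHom? G S)
    (allFuns-unique _ _) (allFuns-enumerates _ _) (hom-resp-≗ {G} {S})

  strict-injection : #Strict G R ≤ #Strict G S → Injection (IsStrictHom G R) (IsStrictHom G S)
  strict-injection = injection-of-length-≤ (strict? G R) (strict? G S)
    (allFuns-enumerates _ _) (allFuns-unique _ _) (strict-resp-≗ {G} {R})

  module _ (maps : ΓMaps G R S) where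
    open ΓMaps maps

    ρ-strict : ∀ {ξ} (ξ-strict : IsStrictHom G R ξ) → IsStrictHom G S (ρ ξ (proj₁ ξ-strict))
    ρ-strict {ξ} (ξ-hom , ξ-star) = ρ-hom ξ ξ-hom , λ v w v-w →
      (λ ρv≡ρw → proj₁ (ξ-star v w v-w)
        (sym (Γ-colour {G} {R} {ξ} (Equivalence.to (ρ-Γ ξ ξ-hom v w) (Γ-step {G} {S} (v-w , ρv≡ρw)))))) ,
      ρ-hom ξ ξ-hom v w (proj₂ v-w)

    ΓMaps-strict-≤ : #Strict G R ≤ #Strict G S
    ΓMaps-strict-≤ = strict-count-≤ record
      { to = λ ξ ξ-strict → ρ ξ (proj₁ ξ-strict)
      ; to-Q = λ ξ ξ-strict → ρ-strict ξ-strict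
      ; to-injective = λ ξ₁ s₁ ξ₂ s₂ → ρ-inj ξ₁ (proj₁ s₁) ξ₂ (proj₁ s₂)
      }

    ΓMaps-hom-≤ : #Hom G R ≤ #Hom G S
    ΓMaps-hom-≤ = hom-count-≤ record { to = ρ ; to-Q = ρ-hom ; to-injective = ρ-inj }

module Descent (G R S : Graph) (ps : List (V G × V G)) (le : #Strict (G / ps) R ≤ #Strict (G / ps) S) where
  open Contraction G ps
  open Counting.Injection (strict-injection {G / ps} {R} {S} le)
    renaming (to to ι; to-Q to ι-strict; to-injective to ι-injective)

  module _ (ξ : V G → V R) (ξ-hom : IsHom G R ξ) (generates : Generates G R ps ξ) where

    η-strict : IsStrictHom (G / ps) R (ξ ∘ root)
    η-strict = descend-strict {R} {ξ} generates ξ-hom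

    lift : V G → V S
    lift = ι (ξ ∘ root) η-strict ∘ project

    lift-hom : IsHom G S lift
    lift-hom u w e = proj₁ (ι-strict (ξ ∘ root) η-strict) (project u) (project w) (project-hom u w e)

    lift-Γ : ∀ v w → InΓ G S lift v w ⇔ InΓ G R ξ v w
    lift-Γ v w = mk⇔
      (Γ-mono {G} {S} {R} {lift} {ξ}
        (linked⇒colour≡ {R} {ξ} generates ∘ lift-collapse {S} {θ} (proj₂ (ι-strict (ξ ∘ root) η-strict))))
      (Γ-mono {G} {R} {S} {ξ} {lift}
        (cong θ ∘ Equivalence.to linked⇔project≡ ∘ sameColour⇒linked {R} {ξ} generates))
      where
      θ : V (G / ps) → V S
      θ = ι (ξ ∘ root) η-strict

  lift-injective : ∀ {ξ₁ ξ₂ : V G → V R} (h₁ : IsHom G R ξ₁) (g₁ : Generates G R ps ξ₁)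
                   (h₂ : IsHom G R ξ₂) (g₂ : Generates G R ps ξ₂) →
                   lift ξ₁ h₁ g₁ ≗ lift ξ₂ h₂ g₂ → ξ₁ ≗ ξ₂
  lift-injective {ξ₁} {ξ₂} h₁ g₁ h₂ g₂ lift≗ v = begin
    ξ₁ v                    ≡⟨ descend-project {R} {ξ₁} g₁ v ⟨
    ξ₁ (root (project v))   ≡⟨ ι-injective _ (η-strict ξ₁ h₁ g₁) _ (η-strict ξ₂ h₂ g₂) θ₁≗θ₂ (project v) ⟩
    ξ₂ (root (project v))   ≡⟨ descend-project {R} {ξ₂} g₂ v ⟩
    ξ₂ v                    ∎
    where
    open ≡-Reasoning
    θ₁ θ₂ : V (G / ps) → V S
    θ₁ = ι (ξ₁ ∘ root) (η-strict ξ₁ h₁ g₁)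
    θ₂ = ι (ξ₂ ∘ root) (η-strict ξ₂ h₂ g₂)
    θ₁≗θ₂ : θ₁ ≗ θ₂
    θ₁≗θ₂ i = subst (λ j → θ₁ j ≡ θ₂ j) (project-root i) (lift≗ (root i))

-- The two count proofs need not agree; inject≤ ignores its bound proof.
descent-injective : ∀ {G R S : Graph} {ps₁ ps₂ : List (V G × V G)} → ps₁ ≡ ps₂ →
  ∀ le₁ le₂ (ξ₁ ξ₂ : V G → V R)
  (h₁ : IsHom G R ξ₁) (g₁ : Generates G R ps₁ ξ₁) (h₂ : IsHom G R ξ₂) (g₂ : Generates G R ps₂ ξ₂) →
  Descent.lift G R S ps₁ le₁ ξ₁ h₁ g₁ ≗ Descent.lift G R S ps₂ le₂ ξ₂ h₂ g₂ → ξ₁ ≗ ξ₂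
descent-injective {G} {R} {S} {ps} refl le₁ le₂ ξ₁ ξ₂ = Descent.lift-injective G R S ps le₁ {ξ₁} {ξ₂}

ΓMaps-of-counts : ∀ {G R S : Graph} →
  (∀ ξ → IsHom G R ξ → #Strict (G / monochromatic G R ξ) R ≤ #Strict (G / monochromatic G R ξ) S) →
  ΓMaps G R S
ΓMaps-of-counts {G} {R} {S} counts = record { ρ = ρ ; ρ-hom = ρ-hom ; ρ-inj = ρ-inj ; ρ-Γ = ρ-Γ }
  where
  generates : ∀ ξ → Generates G R (monochromatic G R ξ) ξ
  generates ξ = monochromatic-generates {G} {R} {ξ}

  ρ : (ξ : V G → V R) → IsHom G R ξ → V G → V S
  ρ ξ ξ-hom = Descent.lift G R S (monochromatic G R ξ) (counts ξ ξ-hom) ξ ξ-hom (generates ξ)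

  ρ-hom : ∀ ξ ξ-hom → IsHom G S (ρ ξ ξ-hom)
  ρ-hom ξ ξ-hom = Descent.lift-hom G R S (monochromatic G R ξ) (counts ξ ξ-hom) ξ ξ-hom (generates ξ)

  ρ-Γ : ∀ ξ ξ-hom v w → InΓ G S (ρ ξ ξ-hom) v w ⇔ InΓ G R ξ v w
  ρ-Γ ξ ξ-hom = Descent.lift-Γ G R S (monochromatic G R ξ) (counts ξ ξ-hom) ξ ξ-hom (generates ξ)

  ρ-inj : ∀ ξ₁ h₁ ξ₂ h₂ → ρ ξ₁ h₁ ≗ ρ ξ₂ h₂ → ξ₁ ≗ ξ₂
  ρ-inj ξ₁ h₁ ξ₂ h₂ ρ≗ =
    descent-injective {G} {R} {S} {monochromatic G R ξ₁} {monochromatic G R ξ₂}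
      (monochromatic-cong {G} {R} {ξ₁} {ξ₂} Γ₁⇔Γ₂)
      (counts ξ₁ h₁) (counts ξ₂ h₂) ξ₁ ξ₂ h₁ (generates ξ₁) h₂ (generates ξ₂) ρ≗
    where
    Γ-transport : ∀ ξ h ξ′ h′ → ρ ξ h ≗ ρ ξ′ h′ → ∀ {v w} → InΓ G R ξ v w → InΓ G R ξ′ v w
    Γ-transport ξ h ξ′ h′ ρ≗ρ′ {v} {w} v~w = Equivalence.to (ρ-Γ ξ′ h′ v w)
      (Γ-resp-≗ {G} {S} {ρ ξ h} {ρ ξ′ h′} ρ≗ρ′ (Equivalence.from (ρ-Γ ξ h v w) v~w))
    Γ₁⇔Γ₂ : ∀ {v w} → InΓ G R ξ₁ v w ⇔ InΓ G R ξ₂ v w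
    Γ₁⇔Γ₂ = mk⇔ (Γ-transport ξ₁ h₁ ξ₂ h₂ ρ≗) (Γ-transport ξ₂ h₂ ξ₁ h₁ (λ v → sym (ρ≗ v)))

Admissible : Graph → (Graph → Set) → Set
Admissible R U' = (∀ G → U' G) ⊎ (InCo R × (∀ G → InCo G → U' G))

contraction-in-class : ∀ {R : Graph} {U' : Graph → Set} → Admissible R U' →
                       ∀ {G} (ξ : V G → V R) → IsHom G R ξ → U' (G / monochromatic G R ξ)
contraction-in-class {R} (inj₁ everything) {G} ξ ξ-hom = everything (G / monochromatic G R ξ)
contraction-in-class {R} (inj₂ (R-bipartite , bipartite⊆U')) {G} ξ ξ-hom =
  bipartite⊆U' (G / ps) (InCo-reflect {G / ps} {R} (proj₂ η-strict) R-bipartite)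
  where
  ps = monochromatic G R ξ
  η-strict : IsStrictHom (G / ps) R (ξ ∘ Contraction.root G ps)
  η-strict = Contraction.descend-strict G ps {R} {ξ} (monochromatic-generates {G} {R} {ξ}) ξ-hom

strictLeq⇒⊑Γ : ∀ {R : Graph} {U' : Graph → Set} → Admissible R U' →
               ∀ {S} → StrictLeq U' R S → R ⊑Γ S wrt U'
strictLeq⇒⊑Γ {R} {U'} hyp {S} strict≤ G _ =
  ΓMaps-of-counts {G} {R} {S} λ ξ ξ-hom →
    strict≤ (G / monochromatic G R ξ) (contraction-in-class {R} {U'} hyp {G} ξ ξ-hom)

theorem4 : (R : Graph) (U' : Graph → Set) →
           ((∀ G → U' G) ⊎ (InCo R × (∀ G → InCo G → U' G))) →
           (S : Graph) →
           ((R ⊑Γ S wrt U') ⇔ StrictLeq U' R S) × (StrictLeq U' R S → HomLeq U' R S)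
theorem4 R U' hyp S =
  mk⇔ (λ R⊑S G G∈U' → ΓMaps-strict-≤ {G} {R} {S} (R⊑S G G∈U')) (strictLeq⇒⊑Γ {R} {U'} hyp {S}) ,
  λ strict≤ G G∈U' → ΓMaps-hom-≤ {G} {R} {S} (strictLeq⇒⊑Γ {R} {U'} hyp {S} strict≤ G G∈U')
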